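{- Let $n = 2k+1 \geq 3$ be odd. Every schedule for an asynchronous single round-robin tournament with $n$ teams has guaranteed rest time at most $k-1$.
   Context: An asynchronous single round-robin tournament with $n$ teams is one in which every pair of distinct teams plays exactly once and no two games are simultaneous; a schedule is a linear ordering of the $\binom{n}{2}$ games. The guaranteed rest time of a schedule is the maximum integer $b$ such that any two games involving the same team are separated by at least $b$ games not involving that team. -}

module Defs where

open import Data.Nat using (ℕ; zero; suc; _+_; _≤_; _<_; _<ᵇ_)
open import Data.Fin using (Fin; toℕ; _≟_)
import Data.Fin as F
open import Data.Bool using (Bool; true; false; _∧_; _∨_; not; T)
open import Data.List using (List; []; _∷_; allFin)
open import Data.Product using (Σ; _×_; _,_; proj₁; proj₂)
open import Relation.Nullary.Decidable using (⌊_⌋)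
open import Relation.Binary.PropositionalEquality using (_≡_)
open import Function.Definitions using (Injective; Surjective)

-- A game between teams of Fin n: an unordered pair {a, b} of distinct
-- teams, represented canonically as (a , b) with a < b.
Game : ℕ → Set
Game n = Σ (Fin n × Fin n) (λ p → proj₁ p F.< proj₂ p)

involves : ∀ {n} → Fin n → Game n → Bool
involves t ((a , b) , _) = ⌊ a ≟ t ⌋ ∨ ⌊ b ≟ t ⌋

-- A schedule: a linear ordering of all games, i.e. a bijection from
-- positions Fin m (m games in total) onto the set of games.
record Schedule (n : ℕ) : Set where
  field
    m      : ℕ
    game   : Fin m → Game n
    inj    : Injective _≡_ _≡_ game
    surj   : Surjective _≡_ _≡_ game

countᵇ : ∀ {A : Set} → (A → Bool) → List A → ℕ
countᵇ P []       = 0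
countᵇ P (x ∷ xs) with P x
... | true  = suc (countᵇ P xs)
... | false = countᵇ P xs

gamesBetweenWithout : ∀ {n} (s : Schedule n) → Fin n →
                      Fin (Schedule.m s) → Fin (Schedule.m s) → ℕ
gamesBetweenWithout s t i j =
  countᵇ (λ p → (toℕ i <ᵇ toℕ p) ∧ (toℕ p <ᵇ toℕ j)
                ∧ not (involves t (Schedule.game s p)))
         (allFin (Schedule.m s))

HasRestTime : ∀ {n} → Schedule n → ℕ → Set
HasRestTime s b =
  ∀ t (i j : Fin (Schedule.m s)) → toℕ i < toℕ j →
  T (involves t (Schedule.game s i)) → T (involves t (Schedule.game s j)) →
  b ≤ gamesBetweenWithout s t i j

module Submission where

-- Let n = 2k + 1.  The first k + 1 games of a schedule
-- contain 2(k + 1) = n + 1 team slots, so by the pigeonhole principle some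
-- team t plays in two of them, at positions i < j ≤ k.  The games strictly
-- between positions i and j number j − i − 1 ≤ k − 1, so at most k − 1 of
-- them avoid t, and the guaranteed rest time is at most k − 1.

open import Defs
open import Data.Nat
  using (ℕ; zero; suc; _+_; _*_; _∸_; _≤_; _<_; _⊔_; _<ᵇ_; z≤n; s≤s)
open import Data.Nat.Properties
  using (<⇒≤; ≤-trans; ≤-reflexive; +-suc; +-identityʳ; +-comm; +-monoʳ-≤;
         ∸-mono; ∸-monoʳ-≤; +-∸-assoc; <ᵇ⇒<; m≤n⇒m⊔n≡n; ⊔-monoʳ-≤;
         ⊔-identityʳ; n≤1+n; module ≤-Reasoning)
open import Data.Fin as F using (Fin; toℕ; inject≤; splitAt; join; _≟_)
open import Data.Fin.Properties
  using (<-cmp; pigeonhole; injective⇒≤; toℕ-inject≤; join-splitAt; suc-injective;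
         <-irrefl; toℕ<n)
open import Data.Bool using (Bool; true; false; _∧_; not; T)
open import Data.Bool.Properties using (T-∧; T-∨)
open import Data.Unit using (tt)
open import Data.List using (tabulate; allFin)
open import Data.Product using (_×_; _,_; proj₁; proj₂; ∃-syntax)
open import Data.Sum using (_⊎_; inj₁; inj₂; [_,_]′)
open import Data.Empty using (⊥-elim)
open import Function using (_∘_; id)
open import Function.Bundles using (Equivalence)
open import Relation.Binary.Definitions using (tri<; tri≈; tri>)
open import Relation.Binary.PropositionalEquality
  using (_≡_; _≢_; refl; sym; trans; cong; subst; subst₂; cong₂; module ≡-Reasoning)
open import Relation.Nullary.Decidable using (⌊_⌋; fromWitness)

countWindow : ∀ {m} (P : Fin m → Bool) (I J : ℕ) →
              (∀ p → T (P p) → I < toℕ p × toℕ p < J) →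
              ∀ {len} (g : Fin len → Fin m) (a : ℕ) →
              (∀ x → toℕ (g x) ≡ a + toℕ x) →
              countᵇ P (tabulate g) ≤ J ∸ (suc I ⊔ a)
countWindow P I J inside {zero}    g a consecutive = z≤n
countWindow P I J inside {suc len} g a consecutive with P (g F.zero) in eq
... | true  = begin
      suc (countᵇ P (tabulate (g ∘ F.suc)))  ≤⟨ s≤s rest ⟩
      suc (J ∸ (suc I ⊔ suc a))              ≡⟨ cong (λ c → suc (J ∸ c)) (m≤n⇒m⊔n≡n (s≤s (<⇒≤ I<a))) ⟩
      suc (J ∸ suc a)                        ≡⟨ sym (+-∸-assoc 1 a<J) ⟩
      J ∸ a                                  ≡⟨ cong (J ∸_) (sym (m≤n⇒m⊔n≡n I<a)) ⟩
      J ∸ (suc I ⊔ a)                        ∎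
  where
  open ≤-Reasoning
  toℕ-head : toℕ (g F.zero) ≡ a
  toℕ-head = trans (consecutive F.zero) (+-identityʳ a)
  head-inside : I < toℕ (g F.zero) × toℕ (g F.zero) < J
  head-inside = inside (g F.zero) (subst T (sym eq) tt)
  I<a : I < a
  I<a = subst (I <_) toℕ-head (proj₁ head-inside)
  a<J : a < J
  a<J = subst (_< J) toℕ-head (proj₂ head-inside)
  rest : countᵇ P (tabulate (g ∘ F.suc)) ≤ J ∸ (suc I ⊔ suc a)
  rest = countWindow P I J inside (g ∘ F.suc) (suc a)
           (λ x → trans (consecutive (F.suc x)) (+-suc a (toℕ x)))
... | false = ≤-trans rest (∸-monoʳ-≤ J (⊔-monoʳ-≤ (suc I) (n≤1+n a)))
  where
  rest : countᵇ P (tabulate (g ∘ F.suc)) ≤ J ∸ (suc I ⊔ suc a)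
  rest = countWindow P I J inside (g ∘ F.suc) (suc a)
           (λ x → trans (consecutive (F.suc x)) (+-suc a (toℕ x)))

countBetween : ∀ {m} (P : Fin m → Bool) (I J : ℕ) →
               (∀ p → T (P p) → I < toℕ p × toℕ p < J) →
               countᵇ P (allFin m) ≤ J ∸ suc I
countBetween P I J inside =
  subst (λ c → countᵇ P (allFin _) ≤ J ∸ c) (⊔-identityʳ (suc I))
    (countWindow P I J inside id 0 (λ _ → refl))

gamesBetweenWithout-≤ : ∀ {n} (s : Schedule n) t (i j : Fin (Schedule.m s)) →
                        gamesBetweenWithout s t i j ≤ toℕ j ∸ suc (toℕ i)
gamesBetweenWithout-≤ s t i j = countBetween resting (toℕ i) (toℕ j) between
  where
  resting : Fin (Schedule.m s) → Bool
  resting p = (toℕ i <ᵇ toℕ p) ∧ (toℕ p <ᵇ toℕ j)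
              ∧ not (involves t (Schedule.game s p))
  between : ∀ p → T (resting p) → toℕ i < toℕ p × toℕ p < toℕ j
  between p holds =
    let (i<p , rest) = Equivalence.to T-∧ holds
        (p<j , _)    = Equivalence.to T-∧ rest
    in <ᵇ⇒< _ _ i<p , <ᵇ⇒< _ _ p<j

restTime-≤-gap : ∀ {n} (s : Schedule n) {b} → HasRestTime s b →
                 ∀ t (i j : Fin (Schedule.m s)) → toℕ i < toℕ j →
                 T (involves t (Schedule.game s i)) →
                 T (involves t (Schedule.game s j)) →
                 b ≤ toℕ j ∸ suc (toℕ i)
restTime-≤-gap s rest t i j i<j plays-i plays-j =
  ≤-trans (rest t i j i<j plays-i plays-j) (gamesBetweenWithout-≤ s t i j)

firstTeam-plays : ∀ {n} (g : Game n) → T (involves (proj₁ (proj₁ g)) g)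
firstTeam-plays ((a , b) , _) =
  Equivalence.from (T-∨ {⌊ a ≟ a ⌋}) (inj₁ (fromWitness {a? = a ≟ a} refl))

secondTeam-plays : ∀ {n} (g : Game n) → T (involves (proj₂ (proj₁ g)) g)
secondTeam-plays ((a , b) , _) =
  Equivalence.from (T-∨ {⌊ a ≟ b ⌋}) (inj₂ (fromWitness {a? = b ≟ b} refl))

module _ {n l : ℕ} (g : Fin l → Game n) where

  -- Each game has two team slots: a slot is a game index tagged left/right.
  Slot : Set
  Slot = Fin l ⊎ Fin l

  slotGame : Slot → Fin l
  slotGame = [ id , id ]′

  slotTeam : Slot → Fin n
  slotTeam (inj₁ p) = proj₁ (proj₁ (g p))
  slotTeam (inj₂ p) = proj₂ (proj₁ (g p))

  slotTeam-plays : ∀ u → T (involves (slotTeam u) (g (slotGame u)))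
  slotTeam-plays (inj₁ p) = firstTeam-plays (g p)
  slotTeam-plays (inj₂ p) = secondTeam-plays (g p)

  -- The two teams of a game differ, so one team in two distinct slots
  -- occupies slots of two distinct games.
  sameTeam⇒distinctGames : ∀ u v → u ≢ v → slotTeam u ≡ slotTeam v →
                           slotGame u ≢ slotGame v
  sameTeam⇒distinctGames (inj₁ p) (inj₁ .p) u≢v _    refl = u≢v refl
  sameTeam⇒distinctGames (inj₂ p) (inj₂ .p) u≢v _    refl = u≢v refl
  sameTeam⇒distinctGames (inj₁ p) (inj₂ .p) _   same refl =
    <-irrefl same (proj₂ (g p))
  sameTeam⇒distinctGames (inj₂ p) (inj₁ .p) _   same refl =
    <-irrefl (sym same) (proj₂ (g p))

  teamInTwoGames : n < l + l →
    ∃[ t ] ∃[ p ] ∃[ q ] p ≢ q × T (involves t (g p)) × T (involves t (g q))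
  teamInTwoGames n<2l with pigeonhole n<2l (slotTeam ∘ splitAt l)
  ... | x , y , x<y , same =
    slotTeam u , slotGame u , slotGame v ,
    sameTeam⇒distinctGames u v u≢v same ,
    slotTeam-plays u ,
    subst (λ t → T (involves t (g (slotGame v)))) (sym same) (slotTeam-plays v)
    where
    u v : Slot
    u = splitAt l x
    v = splitAt l y
    u≢v : u ≢ v
    u≢v u≡v = <-irrefl (begin
      x                ≡⟨ sym (join-splitAt l l x) ⟩
      join l l u       ≡⟨ cong (join l l) u≡v ⟩
      join l l v       ≡⟨ join-splitAt l l y ⟩
      y                ∎) x<y
      where open ≡-Reasoning

  repeatedTeam : n < l + l →
    ∃[ t ] ∃[ p ] ∃[ q ] toℕ p < toℕ q × T (involves t (g p)) × T (involves t (g q))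
  repeatedTeam n<2l with teamInTwoGames n<2l
  ... | t , p , q , p≢q , plays-p , plays-q with <-cmp p q
  ...   | tri< p<q _ _ = t , p , q , p<q , plays-p , plays-q
  ...   | tri≈ _ p≡q _ = ⊥-elim (p≢q p≡q)
  ...   | tri> _ _ q<p = t , q , p , q<p , plays-q , plays-p

-- A schedule with at least l games on fewer than 2l teams has rest time at
-- most l − 2: some team plays twice among the first l games.
restTime-≤-prefix : ∀ {n l} (s : Schedule n) {b} → HasRestTime s b →
                    l ≤ Schedule.m s → n < l + l → b ≤ l ∸ 2
restTime-≤-prefix {l = l} s {b} rest l≤m n<2l
  with repeatedTeam (λ p → Schedule.game s (inject≤ p l≤m)) n<2l
... | t , p , q , p<q , plays-p , plays-q = begin
  b                                               ≤⟨ gap ⟩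
  toℕ (prefix q) ∸ suc (toℕ (prefix p))           ≡⟨ cong₂ (λ i j → j ∸ suc i) (toℕ-inject≤ p l≤m) (toℕ-inject≤ q l≤m) ⟩
  toℕ q ∸ suc (toℕ p)                             ≤⟨ ∸-mono (toℕ<n q) (s≤s (s≤s (z≤n {toℕ p}))) ⟩
  l ∸ 2                                           ∎
  where
  open ≤-Reasoning
  open Schedule s
  prefix : Fin l → Fin m
  prefix p = inject≤ p l≤m
  prefix-< : toℕ (prefix p) < toℕ (prefix q)
  prefix-< = subst₂ _<_ (sym (toℕ-inject≤ p l≤m)) (sym (toℕ-inject≤ q l≤m)) p<q
  gap : b ≤ toℕ (prefix q) ∸ suc (toℕ (prefix p))
  gap = restTime-≤-gap s rest t (prefix p) (prefix q) prefix-< plays-p plays-q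

-- Team 0 meets each of the other n teams, so a schedule on n + 1 teams has
-- at least n games.
schedule-length : ∀ {n} (s : Schedule (suc n)) → n ≤ Schedule.m s
schedule-length {n} s = injective⇒≤ position-injective
  where
  open Schedule s
  gameOfFirstTeam : Fin n → Game (suc n)
  gameOfFirstTeam j = (F.zero , F.suc j) , s≤s z≤n
  position : Fin n → Fin m
  position j = proj₁ (surj (gameOfFirstTeam j))
  position-game : ∀ j → game (position j) ≡ gameOfFirstTeam j
  position-game j = proj₂ (surj (gameOfFirstTeam j)) refl
  position-injective : ∀ {i j} → position i ≡ position j → i ≡ j
  position-injective {i} {j} same = suc-injective (cong (proj₂ ∘ proj₁) (begin
    gameOfFirstTeam i    ≡⟨ sym (position-game i) ⟩
    game (position i)    ≡⟨ cong game same ⟩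
    game (position j)    ≡⟨ position-game j ⟩
    gameOfFirstTeam j    ∎))
    where open ≡-Reasoning

suc≤double : ∀ {k} → 1 ≤ k → suc k ≤ 2 * k
suc≤double {k} 1≤k = begin
  suc k        ≡⟨ +-comm 1 k ⟩
  k + 1        ≤⟨ +-monoʳ-≤ k 1≤k ⟩
  k + k        ≡⟨ cong (k +_) (sym (+-identityʳ k)) ⟩
  2 * k        ∎
  where open ≤-Reasoning

teams<slots : ∀ k → suc (2 * k) < suc k + suc k
teams<slots k = s≤s (≤-reflexive (begin
  suc (k + (k + 0))    ≡⟨ cong (λ j → suc (k + j)) (+-identityʳ k) ⟩
  suc (k + k)          ≡⟨ sym (+-suc k k) ⟩
  k + suc k            ∎))
  where open ≡-Reasoning

proposition4p1 : (k : ℕ) → 1 ≤ k → (s : Schedule (suc (2 * k))) →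
    (b : ℕ) → HasRestTime s b → b ≤ k ∸ 1
proposition4p1 k 1≤k s b rest =
  restTime-≤-prefix s rest k+1≤m (teams<slots k)
  where
  k+1≤m : suc k ≤ Schedule.m s
  k+1≤m = ≤-trans (suc≤double 1≤k) (schedule-length s)
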